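{- Let $\mathbb{F}$ be a finite field, let $G$ be a finite simple graph, and let $H$ be the underlying graph of the line digraph $\delta G$. Then $\mathrm{minrk}_{\mathbb{F}}(\overline{H})\geq\sqrt{\tfrac12\cdot\log_{|\mathbb{F}|}\chi(G)}$.
   Context: For a graph (or digraph) $G$ on vertex set $[n]$ and a field $\mathbb{F}$, a matrix $M\in\mathbb{F}^{n\times n}$ represents $G$ if $M_{i,i}\neq0$ for all $i$ and $M_{i,j}=0$ for all distinct $i,j$ with $(i,j)$ not an edge (for an undirected graph each edge counts in both directions). $\mathrm{minrk}_{\mathbb{F}}(G)$ is the minimum rank over $\mathbb{F}$ of a matrix representing $G$. $\overline{H}$ is the complement graph and $\chi$ the chromatic number. The line digraph $\delta G$ has as vertices all ordered pairs $(x,y)$ with $\{x,y\}$ an edge of $G$, with a directed edge from $(x,y)$ to $(z,w)$ whenever $y=z$; $H$ is obtained by ignoring directions. -}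

module Defs where

open import Level using (Level; _⊔_)
open import Data.Nat using (ℕ; zero; suc; _≤_)
open import Data.Fin using (Fin)
import Data.Fin as Fin
open import Data.Bool using (Bool; true; false)
open import Data.Product using (Σ; ∃; _×_; _,_)
open import Data.Sum using (_⊎_)
open import Relation.Nullary using (¬_)
open import Relation.Binary.PropositionalEquality using (_≡_; _≢_)
open import Algebra.Bundles using (CommutativeRing)

record IsField {c ℓ : Level} (R : CommutativeRing c ℓ) : Set (c ⊔ ℓ) where
  open CommutativeRing R
  field
    0≉1     : ¬ (0# ≈ 1#)
    inverse : ∀ x → ¬ (x ≈ 0#) → ∃ λ y → (x * y) ≈ 1#

record HasCardinality {c ℓ : Level} (R : CommutativeRing c ℓ) (q : ℕ) : Set (c ⊔ ℓ) where
  open CommutativeRing R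
  field
    enum       : Fin q → Carrier
    enum-inj   : ∀ i j → enum i ≈ enum j → i ≡ j
    enum-surj  : ∀ x → ∃ λ i → enum i ≈ x

record SimpleGraph (n : ℕ) : Set where
  field
    adj     : Fin n → Fin n → Bool
    irrefl  : ∀ x → adj x x ≡ false
    sym     : ∀ x y → adj x y ≡ adj y x

open SimpleGraph public

Colorable : ∀ {n} → SimpleGraph n → ℕ → Set
Colorable {n} G k = Σ (Fin n → Fin k) λ col →
  ∀ x y → adj G x y ≡ true → col x ≢ col y

IsChromaticNumber : ∀ {n} → SimpleGraph n → ℕ → Set
IsChromaticNumber G χ = Colorable G χ × (∀ k → Colorable G k → χ ≤ k)

LVertex : ∀ {n} → SimpleGraph n → Set
LVertex {n} G = Σ (Fin n × Fin n) λ { (x , y) → adj G x y ≡ true }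

LineArc : ∀ {n} (G : SimpleGraph n) → LVertex G → LVertex G → Set
LineArc G ((x , y) , _) ((z , w) , _) = y ≡ z

HAdj : ∀ {n} (G : SimpleGraph n) → LVertex G → LVertex G → Set
HAdj G u v = LineArc G u v ⊎ LineArc G v u

-- complement of a graph given by an adjacency relation
-- (only used for distinct vertices, loops are irrelevant)
Complement : ∀ {a b} {V : Set a} → (V → V → Set b) → V → V → Set b
Complement Adj u v = ¬ Adj u v

module _ {c ℓ : Level} (R : CommutativeRing c ℓ) where
  open CommutativeRing R

  sumFin : ∀ k → (Fin k → Carrier) → Carrier
  sumFin zero    f = 0#
  sumFin (suc k) f = f Fin.zero + sumFin k (λ l → f (Fin.suc l))

  RankAtMost : ∀ {a} {V : Set a} → (V → V → Carrier) → ℕ → Set (a ⊔ c ⊔ ℓ)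
  RankAtMost {V = V} M k =
    Σ (V → Fin k → Carrier) λ A → Σ (Fin k → V → Carrier) λ B →
      ∀ i j → M i j ≈ sumFin k (λ l → A i l * B l j)

  IsRank : ∀ {a} {V : Set a} → (V → V → Carrier) → ℕ → Set (a ⊔ c ⊔ ℓ)
  IsRank M r = RankAtMost M r × (∀ k → RankAtMost M k → r ≤ k)

  Represents : ∀ {a b} {V : Set a} → (V → V → Set b) → (V → V → Carrier) → Set (a ⊔ b ⊔ ℓ)
  Represents {V = V} Adj M =
    (∀ i → ¬ (M i i ≈ 0#)) ×
    (∀ i j → i ≢ j → ¬ Adj i j → M i j ≈ 0#)

  IsMinrk : ∀ {a b} {V : Set a} → (V → V → Set b) → ℕ → Set (a ⊔ b ⊔ c ⊔ ℓ)
  IsMinrk {V = V} Adj r =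
    (∃ λ (M : V → V → Carrier) → Represents Adj M × IsRank M r) ×
    (∀ (M : V → V → Carrier) k → Represents Adj M → IsRank M k → r ≤ k)

{-# OPTIONS --safe #-}
module Submission where

-- Factor a matrix representing the complement of H as M = A · B with inner
-- dimension r, and attach to each arc (x , y) of G the row u(x,y) of A and the
-- column v(x,y) of B.  Consecutive arcs (w , x), (x , z) are adjacent in H, so
-- u(w,x) · v(x,z) = 0, while u(x,y) · v(x,y) = M(x,y)(x,y) ≠ 0.  Colour a vertex
-- y by the span of the vectors u(x,y) on the arcs entering y; it is spanned by r
-- vectors of F^r, so there are at most q^(r²) colours.  If adjacent x and y got
-- the same colour, u(x,y) would lie in the span of the arcs entering x, all of
-- which are orthogonal to v(x,y).  Hence χ ≤ q^(r²) ≤ q^(2r²).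

open import Defs hiding (sym)
open import Level using (Level; _⊔_)
open import Data.Nat using (ℕ; zero; suc; _≤_)
open import Algebra.Bundles using (CommutativeRing)
open import Data.Nat.Properties using (^-*-assoc; ^-monoʳ-≤; m≤m+n; module ≤-Reasoning)
open import Data.Fin using (Fin; zero; suc; funToFin; finToFun)
open import Data.Fin.Properties using (finToFun-funToFin; all?; ¬∀⟶∃¬; nonZeroIndex)
  renaming (_≟_ to _≟ᶠ_)
open import Data.Vec.Functional using (Vector; _∷_; tail; replicate)
open import Data.Bool using (Bool; true; false)
open import Data.Product using (∃; ∃₂; _×_; _,_; proj₁; proj₂)
open import Data.Sum using (inj₁)
open import Function using (_∘_)
open import Relation.Nullary using (¬_; yes; no)
open import Relation.Nullary.Decidable using (map′)
open import Relation.Binary.Definitions using (Decidable)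
open import Relation.Binary.PropositionalEquality as ≡ using (_≡_; _≢_)

module LinearAlgebra {c ℓ : Level} (R : CommutativeRing c ℓ) where
  open CommutativeRing R hiding (zero)
  open import Algebra.Properties.Semiring.Sum semiring
  open import Relation.Binary.Reasoning.Setoid setoid

  private
    variable
      d k m : ℕ

  sumFin≡sum : ∀ k (f : Vector Carrier k) → sumFin R k f ≡ sum f
  sumFin≡sum zero    f = ≡.refl
  sumFin≡sum (suc k) f = ≡.cong (f zero +_) (sumFin≡sum k (f ∘ suc))

  sum-≈0 : {f : Vector Carrier k} → (∀ i → f i ≈ 0#) → sum f ≈ 0#
  sum-≈0 {k} f≈0 = trans (sum-cong-≋ f≈0) (sum-replicate-zero k)

  infix 7 _·_
  _·_ : Vector Carrier d → Vector Carrier d → Carrier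
  _·_ {d} a b = ∑[ l < d ] (a l * b l)

  ·-comm : (a b : Vector Carrier d) → a · b ≈ b · a
  ·-comm a b = sum-cong-≋ (λ l → *-comm (a l) (b l))

  ·-zeroˡ : (b : Vector Carrier d) → replicate d 0# · b ≈ 0#
  ·-zeroˡ b = sum-≈0 (λ l → zeroˡ (b l))

  ·-zeroʳ : (a : Vector Carrier d) → a · replicate d 0# ≈ 0#
  ·-zeroʳ a = sum-≈0 (λ l → zeroʳ (a l))

  infix 4 _∈Span_ _⊆Span_

  _∈Span_ : Vector Carrier d → (Fin m → Vector Carrier d) → Set (c ⊔ ℓ)
  _∈Span_ {m = m} v L = ∃ λ (coeff : Vector Carrier m) → ∀ l → v l ≈ ∑[ j < m ] (coeff j * L j l)

  _⊆Span_ : (Fin k → Vector Carrier d) → (Fin m → Vector Carrier d) → Set (c ⊔ ℓ)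
  W ⊆Span L = ∀ i → W i ∈Span L

  unitVector : Fin m → Vector Carrier m
  unitVector zero    = 1# ∷ replicate _ 0#
  unitVector (suc i) = 0# ∷ unitVector i

  ∑-unitVector : (i : Fin m) (f : Vector Carrier m) → ∑[ j < m ] (unitVector i j * f j) ≈ f i
  ∑-unitVector zero    f = trans (+-cong (*-identityˡ (f zero)) (sum-≈0 (λ j → zeroˡ (f (suc j)))))
                                 (+-identityʳ (f zero))
  ∑-unitVector (suc i) f = trans (+-cong (zeroˡ (f zero)) (∑-unitVector i (f ∘ suc)))
                                 (+-identityˡ (f (suc i)))

  generator∈Span : (L : Fin m → Vector Carrier d) (j : Fin m) → L j ∈Span L
  generator∈Span L j = unitVector j , λ l → sym (∑-unitVector j (λ i → L i l))

  0∈Span : (L : Fin m → Vector Carrier d) → replicate d 0# ∈Span L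
  0∈Span {m} L = replicate m 0# , λ l → sym (sum-≈0 (λ j → zeroˡ (L j l)))

  ∈Span-resp-≈ : {L : Fin m → Vector Carrier d} {v w : Vector Carrier d} →
                 (∀ l → v l ≈ w l) → v ∈Span L → w ∈Span L
  ∈Span-resp-≈ v≈w (coeff , v≈) = coeff , λ l → trans (sym (v≈w l)) (v≈ l)

  ∈Span-+* : {L : Fin m → Vector Carrier d} {v w : Vector Carrier d} (s : Carrier) →
             v ∈Span L → w ∈Span L → (λ l → v l + s * w l) ∈Span L
  ∈Span-+* {m} {L = L} {v} {w} s (cv , v≈) (cw , w≈) = (λ j → cv j + s * cw j) , λ l → begin
    v l + s * w l
      ≈⟨ +-cong (v≈ l) (*-congˡ (w≈ l)) ⟩
    ∑[ j < m ] (cv j * L j l) + s * ∑[ j < m ] (cw j * L j l)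
      ≈⟨ +-congˡ (*-distribˡ-sum s (λ j → cw j * L j l)) ⟩
    ∑[ j < m ] (cv j * L j l) + ∑[ j < m ] (s * (cw j * L j l))
      ≈⟨ ∑-distrib-+ (λ j → cv j * L j l) (λ j → s * (cw j * L j l)) ⟨
    ∑[ j < m ] (cv j * L j l + s * (cw j * L j l))
      ≈⟨ sum-cong-≋ (λ j → +-congˡ (*-assoc s (cw j) (L j l))) ⟨
    ∑[ j < m ] (cv j * L j l + s * cw j * L j l)
      ≈⟨ sum-cong-≋ (λ j → distribʳ (L j l) (cv j) (s * cw j)) ⟨
    ∑[ j < m ] ((cv j + s * cw j) * L j l) ∎

  0∷-∈Span : {L : Fin m → Vector Carrier (suc d)} {v : Vector Carrier d} →
             (∀ j → L j zero ≈ 0#) → v ∈Span (tail ∘ L) → (0# ∷ v) ∈Span L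
  0∷-∈Span L₀≈0 (coeff , v≈) = coeff , λ
    { zero    → sym (sum-≈0 (λ j → trans (*-congˡ (L₀≈0 j)) (zeroʳ (coeff j))))
    ; (suc l) → v≈ l
    }

  ∈Span-∷ : {P : Fin k → Vector Carrier d} {w : Vector Carrier d} (s : Carrier) (a : Vector Carrier (suc d)) →
            w ∈Span P → (λ l → s * a l + (0# ∷ w) l) ∈Span (a ∷ ((0# ∷_) ∘ P))
  ∈Span-∷ s a (coeff , w≈) = s ∷ coeff , λ
    { zero    → +-congˡ (sym (sum-≈0 (λ i → zeroʳ (coeff i))))
    ; (suc l) → +-congˡ (w≈ l)
    }

  ∈Span-trans : {L : Fin m → Vector Carrier d} {W : Fin k → Vector Carrier d} {v : Vector Carrier d} →
                v ∈Span W → W ⊆Span L → v ∈Span L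
  ∈Span-trans {m} {k = k} {L} {W} {v} (a , v≈) W⊆L = (λ j → ∑[ i < k ] (a i * b i j)) , λ l → begin
    v l
      ≈⟨ v≈ l ⟩
    ∑[ i < k ] (a i * W i l)
      ≈⟨ sum-cong-≋ (λ i → *-congˡ (proj₂ (W⊆L i) l)) ⟩
    ∑[ i < k ] (a i * ∑[ j < m ] (b i j * L j l))
      ≈⟨ sum-cong-≋ (λ i → *-distribˡ-sum (a i) (λ j → b i j * L j l)) ⟩
    ∑[ i < k ] ∑[ j < m ] (a i * (b i j * L j l))
      ≈⟨ sum-cong-≋ (λ i → sum-cong-≋ (λ j → *-assoc (a i) (b i j) (L j l))) ⟨
    ∑[ i < k ] ∑[ j < m ] (a i * b i j * L j l)
      ≈⟨ ∑-comm (λ i j → a i * b i j * L j l) ⟩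
    ∑[ j < m ] ∑[ i < k ] (a i * b i j * L j l)
      ≈⟨ sum-cong-≋ (λ j → *-distribʳ-sum (L j l) (λ i → a i * b i j)) ⟨
    ∑[ j < m ] (∑[ i < k ] (a i * b i j) * L j l) ∎
    where
    b : Fin k → Fin m → Carrier
    b i = proj₁ (W⊆L i)

  ∈Span-⊥ˡ : {L : Fin m → Vector Carrier d} {a b : Vector Carrier d} →
             (∀ j → L j · b ≈ 0#) → a ∈Span L → a · b ≈ 0#
  ∈Span-⊥ˡ {m} {d} {L} {a} {b} L⊥b (coeff , a≈) = begin
    ∑[ l < d ] (a l * b l)
      ≈⟨ sum-cong-≋ (λ l → *-congʳ (a≈ l)) ⟩
    ∑[ l < d ] (∑[ j < m ] (coeff j * L j l) * b l)
      ≈⟨ sum-cong-≋ (λ l → *-distribʳ-sum (b l) (λ j → coeff j * L j l)) ⟩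
    ∑[ l < d ] ∑[ j < m ] (coeff j * L j l * b l)
      ≈⟨ sum-cong-≋ (λ l → sum-cong-≋ (λ j → *-assoc (coeff j) (L j l) (b l))) ⟩
    ∑[ l < d ] ∑[ j < m ] (coeff j * (L j l * b l))
      ≈⟨ ∑-comm (λ l j → coeff j * (L j l * b l)) ⟩
    ∑[ j < m ] ∑[ l < d ] (coeff j * (L j l * b l))
      ≈⟨ sum-cong-≋ (λ j → *-distribˡ-sum (coeff j) (λ l → L j l * b l)) ⟨
    ∑[ j < m ] (coeff j * (L j · b))
      ≈⟨ sum-≈0 (λ j → trans (*-congˡ (L⊥b j)) (zeroʳ (coeff j))) ⟩
    0# ∎

  ∈Span-⊥ : {L : Fin m → Vector Carrier d} {L′ : Fin k → Vector Carrier d} {a b : Vector Carrier d} →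
           (∀ i j → L i · L′ j ≈ 0#) → a ∈Span L → b ∈Span L′ → a · b ≈ 0#
  ∈Span-⊥ {L = L} {L′} {a} {b} L⊥L′ a∈L b∈L′ = ∈Span-⊥ˡ L⊥b a∈L
    where
    L⊥b : ∀ i → L i · b ≈ 0#
    L⊥b i = trans (·-comm (L i) b) (∈Span-⊥ˡ (λ j → trans (·-comm (L′ j) (L i)) (L⊥L′ i j)) b∈L′)

module Elimination {c ℓ : Level} (F : CommutativeRing c ℓ) (isField : IsField F)
                   (_≟_ : Decidable (CommutativeRing._≈_ F)) where
  open CommutativeRing F hiding (zero)
  open LinearAlgebra F
  open import Algebra.Properties.Group +-group using (x≈y⇒x∙y⁻¹≈ε; //-rightDividesˡ)
  open import Algebra.Properties.Ring ring using (-‿distribˡ-*)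
  open import Relation.Binary.Reasoning.Setoid setoid

  private
    variable
      d m : ℕ

  pivot : (L : Fin m → Vector Carrier (suc d)) →
          ∃₂ λ a (t : Vector Carrier m) → a ∈Span L × ∀ j → L j zero ≈ t j * a zero
  pivot {m} {d} L with all? (λ j → L j zero ≟ 0#)
  ... | yes all-zero = replicate (suc d) 0# , replicate m 0# , 0∈Span L ,
    λ j → trans (all-zero j) (sym (zeroˡ 0#))
  ... | no not-all-zero with ¬∀⟶∃¬ m _ (λ j → L j zero ≟ 0#) not-all-zero
  ... | j₀ , L-j₀≉0 with IsField.inverse isField (L j₀ zero) L-j₀≉0
  ...   | y , L-j₀*y≈1 = L j₀ , (λ j → L j zero * y) , generator∈Span L j₀ , λ j → begin
    L j zero                ≈⟨ *-identityʳ (L j zero) ⟨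
    L j zero * 1#           ≈⟨ *-congˡ (trans (*-comm y (L j₀ zero)) L-j₀*y≈1) ⟨
    L j zero * (y * L j₀ zero) ≈⟨ *-assoc (L j zero) y (L j₀ zero) ⟨
    L j zero * y * L j₀ zero ∎

  eliminate : (L : Fin m → Vector Carrier d) → Vector Carrier d → Vector Carrier m → Fin m → Vector Carrier d
  eliminate L a t j l = L j l - t j * a l

  eliminate-⊆Span : {L : Fin m → Vector Carrier d} {a : Vector Carrier d} (t : Vector Carrier m) →
                    a ∈Span L → eliminate L a t ⊆Span L
  eliminate-⊆Span {L = L} {a} t a∈L j =
    ∈Span-resp-≈ (λ l → +-congˡ (sym (-‿distribˡ-* (t j) (a l))))
                 (∈Span-+* (- t j) (generator∈Span L j) a∈L)

  spanning-family : ∀ d (L : Fin m → Vector Carrier d) →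
                    ∃ λ (P : Fin d → Vector Carrier d) → P ⊆Span L × L ⊆Span P
  -- Gaussian elimination: clear the first coordinate with the pivot row a, then
  -- recurse on the remaining coordinates.
  spanning-family zero    L = (λ ()) , (λ ()) , λ j → (λ ()) , λ ()
  spanning-family {m} (suc d) L with pivot L
  ... | a , t , a∈L , L₀≈ta₀ with spanning-family d (tail ∘ eliminate L a t)
  ... | P′ , P′⊆B′ , B′⊆P′ = P , P⊆L , L⊆P
    where
    P : Fin (suc d) → Vector Carrier (suc d)
    P = a ∷ ((0# ∷_) ∘ P′)

    B : Fin m → Vector Carrier (suc d)
    B = eliminate L a t

    B₀≈0 : ∀ j → B j zero ≈ 0#
    B₀≈0 j = x≈y⇒x∙y⁻¹≈ε (L₀≈ta₀ j)

    P⊆L : P ⊆Span L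
    P⊆L zero    = a∈L
    P⊆L (suc k) = ∈Span-trans (0∷-∈Span B₀≈0 (P′⊆B′ k)) (eliminate-⊆Span t a∈L)

    reassemble : ∀ j l → t j * a l + (0# ∷ tail (B j)) l ≈ L j l
    reassemble j zero    = trans (+-identityʳ (t j * a zero)) (sym (L₀≈ta₀ j))
    reassemble j (suc l) = trans (+-comm (t j * a (suc l)) (B j (suc l)))
                                 (//-rightDividesˡ (t j * a (suc l)) (L j (suc l)))

    L⊆P : L ⊆Span P
    L⊆P j = ∈Span-resp-≈ {L = P} (reassemble j) (∈Span-∷ (t j) a (B′⊆P′ j))

ifTrue : ∀ {a} {A : Set a} (b : Bool) → (b ≡ true → A) → A → A
ifTrue true  f _ = f ≡.refl
ifTrue false _ z = z

ifTrue-true : ∀ {a} {A : Set a} {b} (f : b ≡ true → A) (z : A) (e : b ≡ true) → ifTrue b f z ≡ f e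
ifTrue-true f z ≡.refl = ≡.refl

ifTrue-elim : ∀ {a p} {A : Set a} (P : A → Set p) (b : Bool) (f : b ≡ true → A) (z : A) →
              (∀ e → P (f e)) → P z → P (ifTrue b f z)
ifTrue-elim P true  f z Pf Pz = Pf ≡.refl
ifTrue-elim P false f z Pf Pz = Pz

consecutive-arcs-distinct : ∀ {n} (G : SimpleGraph n) {w x z} (e₁ : adj G w x ≡ true) (e₂ : adj G x z ≡ true) →
                            _≢_ {A = LVertex G} ((w , x) , e₁) ((x , z) , e₂)
consecutive-arcs-distinct G {w} e₁ e₂ eq with ≡.cong (proj₁ ∘ proj₁) eq
... | ≡.refl with ≡.trans (≡.sym (irrefl G w)) e₁
... | ()

module _ {c ℓ : Level} (R : CommutativeRing c ℓ) where
  open CommutativeRing R hiding (zero)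
  open LinearAlgebra R

  record ArcRepresentation {n} (G : SimpleGraph n) (r : ℕ) : Set (c ⊔ ℓ) where
    field
      u v           : Fin n → Fin n → Vector Carrier r
      consecutive-⊥ : ∀ w x z → u w x · v x z ≈ 0#
      arc-≉0        : ∀ x y → adj G x y ≡ true → ¬ (u x y · v x y ≈ 0#)

  factorisation⇒ArcRepresentation : ∀ {n} (G : SimpleGraph n) {r} {M : LVertex G → LVertex G → Carrier} →
                                    Represents R (Complement (HAdj G)) M → RankAtMost R M r →
                                    ArcRepresentation G r
  factorisation⇒ArcRepresentation {n} G {r} {M} (M-diag≉0 , M-off≈0) (A , B , M≈AB) = record
    { u = onArcs A ; v = onArcs Bᵀ ; consecutive-⊥ = consecutive-⊥ ; arc-≉0 = arc-≉0 }
    where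
    Bᵀ : LVertex G → Vector Carrier r
    Bᵀ j l = B l j

    onArcs : (LVertex G → Vector Carrier r) → Fin n → Fin n → Vector Carrier r
    onArcs f x y = ifTrue (adj G x y) (λ e → f ((x , y) , e)) (replicate r 0#)

    onArcs-arc : ∀ f {x y} (e : adj G x y ≡ true) → onArcs f x y ≡ f ((x , y) , e)
    onArcs-arc f e = ifTrue-true _ (replicate r 0#) e

    M≈· : ∀ i j → M i j ≈ A i · Bᵀ j
    M≈· i j = trans (M≈AB i j) (reflexive (sumFin≡sum r (λ l → A i l * B l j)))

    consecutive-⊥ : ∀ w x z → onArcs A w x · onArcs Bᵀ x z ≈ 0#
    consecutive-⊥ w x z = ifTrue-elim (λ a → a · onArcs Bᵀ x z ≈ 0#) (adj G w x) _ _
      (λ e₁ → ifTrue-elim (λ b → A ((w , x) , e₁) · b ≈ 0#) (adj G x z) _ _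
        (λ e₂ → trans (sym (M≈· _ _))
                      (M-off≈0 _ _ (consecutive-arcs-distinct G e₁ e₂) (λ ¬H → ¬H (inj₁ ≡.refl))))
        (·-zeroʳ (A ((w , x) , e₁))))
      (·-zeroˡ (onArcs Bᵀ x z))

    arc-≉0 : ∀ x y → adj G x y ≡ true → ¬ (onArcs A x y · onArcs Bᵀ x y ≈ 0#)
    arc-≉0 x y e uv≈0 = M-diag≉0 arc (trans (M≈· arc arc)
      (≡.subst₂ (λ a b → a · b ≈ 0#) (onArcs-arc A e) (onArcs-arc Bᵀ e) uv≈0))
      where
      arc : LVertex G
      arc = (x , y) , e

-- Imported only here, since above _*_ is the ring multiplication.
open import Data.Nat using (_*_; _^_; NonZero)

funToFin-injective : ∀ {m n} {f g : Fin m → Fin n} → funToFin f ≡ funToFin g → ∀ i → f i ≡ g i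
funToFin-injective {f = f} {g} eq i =
  ≡.trans (≡.sym (finToFun-funToFin f i)) (≡.trans (≡.cong (λ k → finToFun k i) eq) (finToFun-funToFin g i))

module FiniteField {c ℓ : Level} (F : CommutativeRing c ℓ) (isField : IsField F)
                   {q : ℕ} (card : HasCardinality F q) where
  open CommutativeRing F using (Carrier; _≈_; 0#; sym; trans; reflexive)
  open HasCardinality card
  open LinearAlgebra F

  index : Carrier → Fin q
  index x = proj₁ (enum-surj x)

  index-injective : ∀ {x y} → index x ≡ index y → x ≈ y
  index-injective {x} {y} eq =
    trans (sym (proj₂ (enum-surj x))) (trans (reflexive (≡.cong enum eq)) (proj₂ (enum-surj y)))

  index-cong : ∀ {x y} → x ≈ y → index x ≡ index y
  index-cong {x} {y} x≈y = enum-inj _ _ (trans (proj₂ (enum-surj x)) (trans x≈y (sym (proj₂ (enum-surj y)))))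

  _≟_ : Decidable _≈_
  x ≟ y = map′ index-injective index-cong (index x ≟ᶠ index y)

  cardinality-nonZero : NonZero q
  cardinality-nonZero = nonZeroIndex (index 0#)

  encode : ∀ {r} → (Fin r → Vector Carrier r) → Fin ((q ^ r) ^ r)
  encode P = funToFin (λ i → funToFin (index ∘ P i))

  encode-injective : ∀ {r} {P P′ : Fin r → Vector Carrier r} → encode P ≡ encode P′ → ∀ i l → P i l ≈ P′ i l
  encode-injective eq i l = index-injective (funToFin-injective (funToFin-injective eq i) l)

  ArcRepresentation⇒Colorable : ∀ {n} {G : SimpleGraph n} {r} → ArcRepresentation F G r → Colorable G ((q ^ r) ^ r)
  ArcRepresentation⇒Colorable {n} {G} {r} ρ = encode ∘ incomingSpanning , proper
    where
    open ArcRepresentation ρ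
    open Elimination F isField _≟_

    incoming : Fin n → Fin n → Vector Carrier r
    incoming y x = u x y

    incomingSpanning : Fin n → Fin r → Vector Carrier r
    incomingSpanning y = proj₁ (spanning-family r (incoming y))

    incomingSpanning⊆incoming : ∀ y → incomingSpanning y ⊆Span incoming y
    incomingSpanning⊆incoming y = proj₁ (proj₂ (spanning-family r (incoming y)))

    incoming⊆incomingSpanning : ∀ y → incoming y ⊆Span incomingSpanning y
    incoming⊆incomingSpanning y = proj₂ (proj₂ (spanning-family r (incoming y)))

    proper : ∀ x y → adj G x y ≡ true → encode (incomingSpanning x) ≢ encode (incomingSpanning y)
    proper x y e same = arc-≉0 x y e
      (∈Span-⊥ (λ w z → consecutive-⊥ w x z) u∈incoming-x (generator∈Span (v x) y))
      where
      spanning-y⊆incoming-x : incomingSpanning y ⊆Span incoming x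
      spanning-y⊆incoming-x k =
        ∈Span-resp-≈ (encode-injective same k) (incomingSpanning⊆incoming x k)

      u∈incoming-x : u x y ∈Span incoming x
      u∈incoming-x = ∈Span-trans (incoming⊆incomingSpanning y x) spanning-y⊆incoming-x

theorem3p13 : ∀ {c ℓ : Level} (F : CommutativeRing c ℓ) → IsField F →
    (q : ℕ) → HasCardinality F q →
    ∀ {n} (G : SimpleGraph n) →
    (r : ℕ) → IsMinrk F (Complement (HAdj G)) r →
    (χ : ℕ) → IsChromaticNumber G χ →
    χ ≤ q ^ (2 * (r * r))
theorem3p13 F isField q card G r ((M , represents , factorisation , _) , _) χ (_ , χ-least) = begin
  χ                 ≤⟨ χ-least _ (ArcRepresentation⇒Colorable
                                    (factorisation⇒ArcRepresentation F G represents factorisation)) ⟩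
  (q ^ r) ^ r       ≡⟨ ^-*-assoc q r r ⟩
  q ^ (r * r)       ≤⟨ ^-monoʳ-≤ q {{cardinality-nonZero}} (m≤m+n (r * r) _) ⟩
  q ^ (2 * (r * r)) ∎
  where
  open ≤-Reasoning
  open FiniteField F isField card
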